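{- Assume the Dickson--Hardy--Littlewood conjecture: every admissible tuple $(h_1,\dots,h_k)$ of natural numbers is prime-producing. Then there exists an infinite set $B$ of primes such that $b+b'+1$ is prime for every pair of distinct $b,b' \in B$.
   Context: A tuple $(h_1,\dots,h_k)$ of natural numbers is admissible if for each prime $p$ there is at least one residue class mod $p$ containing none of $h_1,\dots,h_k$. A tuple $(h_1,\dots,h_k)$ is prime-producing if there are infinitely many integers $n$ such that $n+h_1,\dots,n+h_k$ are all prime. Natural numbers are $\{1,2,3,\dots\}$. -}

module Defs where

open import Data.Nat using (ℕ; _+_; _≤_; _≥_; _%_)
open import Data.Nat.Primality using (Prime; prime⇒nonZero)
open import Data.Fin using (Fin; toℕ)
open import Data.Product using (Σ; _×_)
open import Relation.Binary.PropositionalEquality using (_≢_)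

-- A tuple (h_1,...,h_k) is represented by h : Fin k → ℕ; "natural numbers"
-- means {1,2,3,...}, imposed separately as  ∀ i → 1 ≤ h i .

Admissible : (k : ℕ) → (Fin k → ℕ) → Set
Admissible k h =
  (p : ℕ) → (pp : Prime p) → Σ (Fin p) λ r → (i : Fin k) →
    _%_ (h i) p {{prime⇒nonZero pp}} ≢ toℕ r

-- Prime-producing: infinitely many n with all n + h_i prime.
-- (Since h_i ≥ 1, only finitely many negative integers n could qualify,
-- so it is equivalent to ask for infinitely many natural n ≥ 0.)
PrimeProducing : (k : ℕ) → (Fin k → ℕ) → Set
PrimeProducing k h =
  (N : ℕ) → Σ ℕ λ n → (n ≥ N) × ((i : Fin k) → Prime (n + h i))

DHL : Set
DHL = (k : ℕ) → (h : Fin k → ℕ) → ((i : Fin k) → 1 ≤ h i) →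
      Admissible k h → PrimeProducing k h

Infinite : (ℕ → Set) → Set
Infinite B = (N : ℕ) → Σ ℕ λ b → (b ≥ N) × B b

{-# OPTIONS --safe #-}
module Submission where

open import Defs
open import Data.Nat using (ℕ; _+_)
open import Data.Nat.Primality using (Prime)
open import Data.Product using (Σ; _×_)
open import Relation.Binary.PropositionalEquality using (_≢_)

open import Data.Nat using (zero; suc; pred; _*_; _≤_; _≤′_; _<_; _%_; _⊔_; z≤n; s≤s; NonZero; nonTrivial⇒n>1)
open import Data.Nat.Properties
open import Data.Nat.Divisibility
open import Data.Nat.DivMod using (_mod_; %-distribˡ-+)
open import Data.Nat.Primality using (prime⇒nonZero; prime⇒irreducible; prime⇒nonTrivial)
open import Data.Nat.Solver using (module +-*-Solver)
open import Data.Fin using (Fin; toℕ) renaming (zero to fzero; suc to fsuc)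
open import Data.Fin.Properties using (toℕ-fromℕ<)
open import Data.List using (List; []; _∷_; length; lookup)
open import Data.List.Membership.Propositional using (_∈_; lose; find)
open import Data.List.Membership.Propositional.Properties using (∈-lookup)
open import Data.List.Relation.Binary.Subset.Propositional using (_⊆_)
open import Data.List.Relation.Unary.Any using (here; there; index; any?)
open import Data.List.Relation.Unary.Any.Properties using (lookup-index)
open import Data.Product using (_,_; proj₁; proj₂; ∃)
open import Data.Sum using (inj₁; inj₂)
open import Data.Empty using (⊥-elim)
open import Relation.Nullary using (yes; no)
open import Relation.Binary.PropositionalEquality using (_≡_; refl; sym; trans; cong; subst; module ≡-Reasoning)

-- Build B = {b₀, b₁, …} greedily. Given primes b₀, …, bₘ₋₁ ≥ 5 with all pairwise
-- sums bᵢ + bⱼ + 1 prime, the tuple (1, b₀ + 2, …, bₘ₋₁ + 2) is admissible, so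
-- DHL yields arbitrarily large n with n + 1 and every n + bᵢ + 2 prime, and
-- bₘ = n + 1 extends the family. For admissibility at p, the residue class
-- 2 mod p is free unless p is some bᵢ, hence p ≥ 5; then 3 mod p is free unless
-- p ∣ bⱼ − 1 for some j, and in that case 0 mod p is free: p ∣ bᵢ + 2 would give
-- p ∣ 3 if i = j, and otherwise p ∣ bᵢ + bⱼ + 1, a prime larger than p.

prime≥2 : ∀ {p} → Prime p → 2 ≤ p
prime≥2 {p} pp = nonTrivial⇒n>1 p {{prime⇒nonTrivial pp}}

∣-prime⇒≡ : ∀ {d p} → Prime d → Prime p → d ∣ p → d ≡ p
∣-prime⇒≡ pd pp d∣p with prime⇒irreducible pp d∣p
... | inj₁ refl = ⊥-elim (<⇒≱ (prime≥2 pd) ≤-refl)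
... | inj₂ d≡p  = d≡p

≡-mod⇒∣-shift : ∀ {a b s} p .{{_ : NonZero p}} → a % p ≡ b % p → p ∣ b + s → p ∣ a + s
≡-mod⇒∣-shift {a} {b} {s} p a≡b p∣b+s = m%n≡0⇒n∣m (a + s) p (begin
  (a + s) % p           ≡⟨ %-distribˡ-+ a s p ⟩
  (a % p + s % p) % p   ≡⟨ cong (λ z → (z + s % p) % p) a≡b ⟩
  (b % p + s % p) % p   ≡⟨ %-distribˡ-+ b s p ⟨
  (b + s) % p           ≡⟨ n∣m⇒m%n≡0 (b + s) p p∣b+s ⟩
  0                     ∎)
  where open ≡-Reasoning

-- The free class is −s mod p, represented by (p − 1) * s.
free-residue : ∀ {k} (h : Fin k → ℕ) p .{{_ : NonZero p}} s →
               (∀ i → p ∤ h i + s) → Σ (Fin p) λ r → ∀ i → h i % p ≢ toℕ r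
free-residue h p@(suc q) s p∤h+s = (q * s) mod p , λ i h≡r →
  p∤h+s i (≡-mod⇒∣-shift {h i} {q * s} p (trans h≡r (toℕ-fromℕ< _)) p∣c+s)
  where
  p∣c+s : p ∣ q * s + s
  p∣c+s = subst (p ∣_) (+-comm s (q * s)) (m∣m*n s)

record PairwisePrimeSums (bs : List ℕ) : Set where
  field
    prime       : ∀ {x} → x ∈ bs → Prime x
    ≥5          : ∀ {x} → x ∈ bs → 5 ≤ x
    sum+1-prime : ∀ {x y} → x ∈ bs → y ∈ bs → x ≢ y → Prime (x + y + 1)
open PairwisePrimeSums

[]-pairwisePrimeSums : PairwisePrimeSums []
[]-pairwisePrimeSums = record { prime = λ () ; ≥5 = λ () ; sum+1-prime = λ () }

∷-pairwisePrimeSums : ∀ {b bs} → PairwisePrimeSums bs → Prime b → 5 ≤ b →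
                      (∀ {x} → x ∈ bs → Prime (b + x + 1)) → PairwisePrimeSums (b ∷ bs)
∷-pairwisePrimeSums {b} {bs} P pb b≥5 pb+x+1 = record
  { prime       = λ { (here refl) → pb ; (there x∈) → prime P x∈ }
  ; ≥5          = λ { (here refl) → b≥5 ; (there x∈) → ≥5 P x∈ }
  ; sum+1-prime = sum+1
  }
  where
  sum+1 : ∀ {x y} → x ∈ b ∷ bs → y ∈ b ∷ bs → x ≢ y → Prime (x + y + 1)
  sum+1     (here refl) (here refl) x≢y = ⊥-elim (x≢y refl)
  sum+1     (here refl) (there y∈)  _   = pb+x+1 y∈
  sum+1 {x} (there x∈)  (here refl) _   = subst (λ z → Prime (z + 1)) (+-comm b x) (pb+x+1 x∈)
  sum+1     (there x∈)  (there y∈)  x≢y = sum+1-prime P x∈ y∈ x≢y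

candidates : (bs : List ℕ) → Fin (suc (length bs)) → ℕ
candidates bs fzero    = 1
candidates bs (fsuc i) = lookup bs i + 2

candidates≥1 : ∀ bs i → 1 ≤ candidates bs i
candidates≥1 bs fzero    = ≤-refl
candidates≥1 bs (fsuc i) = ≤-trans (n≤1+n 1) (m≤n+m 2 (lookup bs i))

candidates-avoid : ∀ {p s} bs → p ∤ 1 + s → (∀ {x} → x ∈ bs → p ∤ x + 2 + s) →
                   ∀ i → p ∤ candidates bs i + s
candidates-avoid bs p∤1+s _       fzero    = p∤1+s
candidates-avoid bs _     p∤x+2+s (fsuc i) = p∤x+2+s (∈-lookup i)

open +-*-Solver

x+2+y≡x+[1+y]+1 : ∀ x y → x + 2 + y ≡ x + suc y + 1
x+2+y≡x+[1+y]+1 = solve 2 (λ x y → x :+ con 2 :+ y := x :+ (con 1 :+ y) :+ con 1) refl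

[1+y]+2+y≡2y+3 : ∀ y → suc y + 2 + y ≡ (y + y) + 3
[1+y]+2+y≡2y+3 = solve 1 (λ y → (con 1 :+ y) :+ con 2 :+ y := (y :+ y) :+ con 3) refl

x+2+q≡[2+q]+x : ∀ x q → x + 2 + q ≡ (2 + q) + x
x+2+q≡[2+q]+x = solve 2 (λ x q → x :+ con 2 :+ q := (con 2 :+ q) :+ x) refl

[1+x]+2+q≡[3+q]+x : ∀ x q → suc x + 2 + q ≡ (3 + q) + x
[1+x]+2+q≡[3+q]+x = solve 2 (λ x q → (con 1 :+ x) :+ con 2 :+ q := (con 3 :+ q) :+ x) refl

∣[p+x]⇒∣x : ∀ {p x y} → p + x ≡ y → p ∣ y → p ∣ x
∣[p+x]⇒∣x eq p∣y = ∣m+n∣m⇒∣n (subst (_ ∣_) (sym eq) p∣y) ∣-refl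

∣pred⇒zero-class-free : ∀ {p y bs} → PairwisePrimeSums bs → Prime p → 5 ≤ p →
  y ∈ bs → p ∣ pred y → p ∤ 1 × (∀ {x} → x ∈ bs → p ∤ x + 2)
∣pred⇒zero-class-free {y = 0} P _ _ y∈ _ = ⊥-elim (<⇒≱ (≥5 P y∈) z≤n)
∣pred⇒zero-class-free {y = 1} P _ _ y∈ _ = ⊥-elim (<⇒≱ (≥5 P y∈) (s≤s z≤n))
∣pred⇒zero-class-free {p} {suc y@(suc _)} {bs} P pp p≥5 y∈ p∣y =
  (λ p∣1 → <⇒≢ (prime≥2 pp) (sym (∣1⇒≡1 p∣1))) , p∤x+2
  where
  p∤x+2 : ∀ {x} → x ∈ bs → p ∤ x + 2
  p∤x+2 {x} x∈ p∣x+2 with x ≟ suc y | ∣m∣n⇒∣m+n p∣x+2 p∣y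
  ... | yes refl | p∣sum = <⇒≱ p≥5 (≤-trans (∣⇒≤ p∣3) (n≤1+n 3))
    where
    p∣3 : p ∣ 3
    p∣3 = ∣m+n∣m⇒∣n (subst (p ∣_) ([1+y]+2+y≡2y+3 y) p∣sum) (∣m∣n⇒∣m+n p∣y p∣y)
  ... | no x≢y | p∣sum = <⇒≢ p<sum (∣-prime⇒≡ pp (sum+1-prime P x∈ y∈ x≢y)
                                                       (subst (p ∣_) (x+2+y≡x+[1+y]+1 x y) p∣sum))
    where
    p<sum : p < x + suc y + 1
    p<sum = ≤-trans (s≤s (∣⇒≤ p∣y)) (≤-trans (m≤n+m (suc y) x) (m≤m+n _ 1))

free-shift-≥5 : ∀ {p bs} → PairwisePrimeSums bs → Prime p → 5 ≤ p →
  ∃ λ s → p ∤ 1 + s × (∀ {x} → x ∈ bs → p ∤ x + 2 + s)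
free-shift-≥5 {0} _ _ ()
free-shift-≥5 {1} _ _ (s≤s ())
free-shift-≥5 {2} _ _ (s≤s (s≤s ()))
free-shift-≥5 {p@(suc (suc (suc q)))} {bs} P pp p≥5 with any? (λ y → p ∣? pred y) bs
... | yes ∃y = let y , y∈ , p∣y = find ∃y
                   p∤1 , p∤x+2 = ∣pred⇒zero-class-free P pp p≥5 y∈ p∣y
               in 0 , p∤1 , λ x∈ p∣ → p∤x+2 x∈ (subst (p ∣_) (+-identityʳ _) p∣)
... | no ∄y = q , >⇒∤ (s≤s (s≤s (n≤1+n q))) , λ x∈ p∣ → ∄y (lose x∈ (p∣pred x∈ p∣))
  where
  p∣pred : ∀ {x} → x ∈ bs → p ∣ x + 2 + q → p ∣ pred x
  p∣pred {suc x} _ = ∣[p+x]⇒∣x (sym ([1+x]+2+q≡[3+q]+x x q))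
  p∣pred {zero} x∈ = ⊥-elim (<⇒≱ (≥5 P x∈) z≤n)

free-shift : ∀ {p bs} → PairwisePrimeSums bs → Prime p →
  ∃ λ s → p ∤ 1 + s × (∀ {x} → x ∈ bs → p ∤ x + 2 + s)
free-shift {0} _ pp = ⊥-elim (<⇒≱ (prime≥2 pp) z≤n)
free-shift {1} _ pp = ⊥-elim (<⇒≱ (prime≥2 pp) (s≤s z≤n))
free-shift {p@(suc (suc q))} {bs} P pp with any? (p ∣?_) bs
... | yes ∃x = let x , x∈ , p∣x = find ∃x in
  free-shift-≥5 P pp (subst (5 ≤_) (sym (∣-prime⇒≡ pp (prime P x∈) p∣x)) (≥5 P x∈))
... | no ∄x = q , >⇒∤ (s≤s (n<1+n q)) ,
  λ x∈ p∣ → ∄x (lose x∈ (∣[p+x]⇒∣x (sym (x+2+q≡[2+q]+x _ q)) p∣))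

candidates-admissible : ∀ {bs} → PairwisePrimeSums bs → Admissible (suc (length bs)) (candidates bs)
candidates-admissible {bs} P p pp =
  let s , p∤1+s , p∤x+2+s = free-shift P pp in
  free-residue (candidates bs) p {{prime⇒nonZero pp}} s (candidates-avoid bs p∤1+s p∤x+2+s)

n+[x+2]≡[n+1]+x+1 : ∀ n x → n + (x + 2) ≡ n + 1 + x + 1
n+[x+2]≡[n+1]+x+1 = solve 2 (λ n x → n :+ (x :+ con 2) := n :+ con 1 :+ x :+ con 1) refl

module _ (dhl : DHL) where

  extend : ∀ {bs} → PairwisePrimeSums bs → (M : ℕ) →
           ∃ λ b → M ≤ b × PairwisePrimeSums (b ∷ bs)
  extend {bs} P M with dhl (suc (length bs)) (candidates bs) (candidates≥1 bs) (candidates-admissible P) (4 + M)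
  ... | n , n≥4+M , all-prime = n + 1 , M≤n+1 ,
        ∷-pairwisePrimeSums P (all-prime fzero) n+1≥5 n+1+x+1-prime
    where
    M≤n+1 : M ≤ n + 1
    M≤n+1 = ≤-trans (m≤n+m M 4) (≤-trans n≥4+M (m≤m+n n 1))
    n+1≥5 : 5 ≤ n + 1
    n+1≥5 = subst (5 ≤_) (+-comm 1 n) (s≤s (≤-trans (m≤m+n 4 M) n≥4+M))
    n+1+x+1-prime : ∀ {x} → x ∈ bs → Prime (n + 1 + x + 1)
    n+1+x+1-prime {x} x∈ = subst Prime
      (trans (cong (λ z → n + (z + 2)) (sym (lookup-index x∈))) (n+[x+2]≡[n+1]+x+1 n x))
      (all-prime (fsuc (index x∈)))

  stage : ℕ → Σ (List ℕ) PairwisePrimeSums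
  stage zero    = [] , []-pairwisePrimeSums
  stage (suc m) = let b , _ , P = extend (proj₂ (stage m)) m in b ∷ proj₁ (stage m) , P

  stage-bound : ∀ m → ∃ λ b → m ≤ b × b ∈ proj₁ (stage (suc m))
  stage-bound m = let b , m≤b , _ = extend (proj₂ (stage m)) m in b , m≤b , here refl

  stage-mono : ∀ {m n} → m ≤′ n → proj₁ (stage m) ⊆ proj₁ (stage n)
  stage-mono (_≤′_.≤′-reflexive refl) x∈ = x∈
  stage-mono (_≤′_.≤′-step m≤′n)      x∈ = there (stage-mono m≤′n x∈)

theorem1p3 : DHL →
    Σ (ℕ → Set) λ B →
      Infinite B ×
      ((b : ℕ) → B b → Prime b) ×
      ((b b′ : ℕ) → B b → B b′ → b ≢ b′ → Prime (b + b′ + 1))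
theorem1p3 dhl = B , B-infinite , (λ _ (m , b∈) → prime (proj₂ (stage dhl m)) b∈) , B-sums
  where
  B : ℕ → Set
  B b = ∃ λ m → b ∈ proj₁ (stage dhl m)
  B-infinite : Infinite B
  B-infinite N = let b , N≤b , b∈ = stage-bound dhl N in b , N≤b , suc N , b∈
  B-sums : (b b′ : ℕ) → B b → B b′ → b ≢ b′ → Prime (b + b′ + 1)
  B-sums _ _ (m , b∈) (m′ , b′∈) =
    sum+1-prime (proj₂ (stage dhl (m ⊔ m′)))
      (stage-mono dhl (≤⇒≤′ (m≤m⊔n m m′)) b∈) (stage-mono dhl (≤⇒≤′ (m≤n⊔m m m′)) b′∈)
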